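{- Let $\mathbf{n}=(n_1,\dots,n_s)\in\mathbb{N}^s$. Then \[ a_\mathbf{n}=(f_\mathbf{n}(\alpha_1),\dots,f_\mathbf{n}(\alpha_s))+\sum_{j=1}^sn_ja_{\mathbf{n}-\mathbf{e}_j}. \] Moreover, if $k,\ell\in\{1,\dots,s\}$ and $n_k\ge1$, then \[ a_{\mathbf{n}+\mathbf{e}_\ell-\mathbf{e}_k}=a_\mathbf{n}+(\alpha_k-\alpha_\ell)a_{\mathbf{n}-\mathbf{e}_k}. \]
   Context: $K$ is a number field and $\alpha_1,\dots,\alpha_s\in K$ are distinct. For $\mathbf{m}=(m_1,\dots,m_s)\in\mathbb{N}^s$ with $M=m_1+\dots+m_s$: $f_\mathbf{m}(z)=\prod_{i=1}^s(z-\alpha_i)^{m_i}$, $P_\mathbf{m}(z)=\sum_{k=0}^Mf_\mathbf{m}^{(k)}(z)$, $a_\mathbf{m}=(P_\mathbf{m}(\alpha_1),\dots,P_\mathbf{m}(\alpha_s))\in K^s$. For $\mathbf{m}\in\mathbb{Z}^s\setminus\mathbb{N}^s$, by convention $f_\mathbf{m}=P_\mathbf{m}=0$ and $a_\mathbf{m}=(0,\dots,0)$. $\mathbf{e}_1,\dots,\mathbf{e}_s$ is the standard basis of $\mathbb{Z}^s$. -}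

module Defs where

open import Level using (Level; _⊔_)
open import Algebra.Bundles using (CommutativeRing)
open import Algebra.Morphism.Structures using (module RingMorphisms)
open import Data.Nat as ℕ using (ℕ; zero; suc)
open import Data.Integer as ℤ using (ℤ; +_; -[1+_])
open import Data.Fin as Fin using (Fin; _≟_)
open import Data.Fin.Properties using (all?)
open import Data.List using (List; []; _∷_; replicate)
open import Data.Product using (Σ; ∃; _,_)
open import Data.Empty using (⊥)
open import Relation.Nullary using (¬_; yes; no)
open import Relation.Binary.PropositionalEquality using (_≡_)
import Data.Rational as ℚ
import Algebra.Properties.Monoid.Sum as MonoidSum

module WithRing {c ℓ : Level} (K : CommutativeRing c ℓ) where
  open CommutativeRing K public
  open MonoidSum +-monoid public using (sum)
  open import Algebra.Definitions.RawMonoid +-rawMonoid public using () renaming (_×_ to _·_)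

  record IsNumberField : Set (c ⊔ ℓ) where
    field
      nontrivial : ¬ (1# ≈ 0#)
      inverse    : ∀ x → ¬ (x ≈ 0#) → ∃ λ y → x * y ≈ 1#
      ι          : ℚ.ℚ → Carrier
      ι-isRingHomomorphism :
        RingMorphisms.IsRingHomomorphism ℚ.+-*-rawRing rawRing ι
      dim        : ℕ
      basis      : Fin dim → Carrier
      spanning   : ∀ x → ∃ λ (q : Fin dim → ℚ.ℚ) →
                     x ≈ sum (λ i → ι (q i) * basis i)

  -- Univariate polynomials over K as coefficient lists
  -- (c₀ ∷ c₁ ∷ …  represents c₀ + c₁ z + c₂ z² + …).
  Poly : Set c
  Poly = List Carrier

  _⊕_ : Poly → Poly → Poly
  []       ⊕ q        = q
  (a ∷ p)  ⊕ []       = a ∷ p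
  (a ∷ p)  ⊕ (b ∷ q)  = (a + b) ∷ (p ⊕ q)

  scale : Carrier → Poly → Poly
  scale a []      = []
  scale a (b ∷ p) = (a * b) ∷ scale a p

  _⊗_ : Poly → Poly → Poly
  []      ⊗ q = []
  (a ∷ p) ⊗ q = scale a q ⊕ (0# ∷ (p ⊗ q))

  constP : Carrier → Poly
  constP a = a ∷ []

  linear : Carrier → Poly
  linear α = (- α) ∷ 1# ∷ []

  _^P_ : Poly → ℕ → Poly
  p ^P zero  = constP 1#
  p ^P suc n = p ⊗ (p ^P n)

  eval : Poly → Carrier → Carrier
  eval []      x = 0#
  eval (a ∷ p) x = a + x * eval p x

  derivAux : ℕ → Poly → Poly
  derivAux k []      = []
  derivAux k (a ∷ p) = (k · a) ∷ derivAux (suc k) p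

  deriv : Poly → Poly
  deriv []      = []
  deriv (a ∷ p) = derivAux 1 p

  deriv^ : ℕ → Poly → Poly
  deriv^ zero    p = p
  deriv^ (suc k) p = deriv (deriv^ k p)

  module Points {s : ℕ} (α : Fin s → Carrier) where

    prodP : ∀ {t} → (Fin t → Poly) → Poly
    prodP {zero}  g = constP 1#
    prodP {suc t} g = g Fin.zero ⊗ prodP (λ i → g (Fin.suc i))

    total : ∀ {t} → (Fin t → ℕ) → ℕ
    total {zero}  m = 0
    total {suc t} m = m Fin.zero ℕ.+ total (λ i → m (Fin.suc i))

    f : (Fin s → ℕ) → Poly
    f m = prodP (λ i → linear (α i) ^P m i)

    sumUpTo : ℕ → (ℕ → Carrier) → Carrier
    sumUpTo zero    g = g 0
    sumUpTo (suc n) g = sumUpTo n g + g (suc n)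

    evalP : (Fin s → ℕ) → Carrier → Carrier
    evalP m x = sumUpTo (total m) (λ k → eval (deriv^ k (f m)) x)

    aℕ : (Fin s → ℕ) → Fin s → Carrier
    aℕ m i = evalP m (α i)

    -- a_m for m ∈ ℤ^s, with the convention a_m = (0,…,0) when m ∉ ℕ^s
    a : (Fin s → ℤ) → Fin s → Carrier
    a m with all? (λ i → + 0 ℤ.≤? m i)
    ... | yes _ = aℕ (λ i → ℤ.∣ m i ∣)
    ... | no  _ = λ _ → 0#

  e : ∀ {s} → Fin s → Fin s → ℤ
  e j i with i ≟ j
  ... | yes _ = + 1
  ... | no  _ = + 0

  _⊞_ : ∀ {s} → (Fin s → ℤ) → (Fin s → ℤ) → Fin s → ℤ
  (m ⊞ n) i = m i ℤ.+ n i

  _⊟_ : ∀ {s} → (Fin s → ℤ) → (Fin s → ℤ) → Fin s → ℤ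
  (m ⊟ n) i = m i ℤ.- n i

  ↑ : ∀ {s} → (Fin s → ℕ) → Fin s → ℤ
  ↑ n i = + (n i)

{-# OPTIONS --safe #-}
-- As deg f_m = M, the sum may run
-- one step further, so P_m = f_m + Σ_{k ≤ M} (f_m′)^(k); by Leibniz f_m′ = Σ_j m_j f_{m−e_j}, and
-- as deg f_{m−e_j} = M − 1 each of these sums is P_{m−e_j}, which is the first identity.  For the
-- second, f_{n+e_l−e_k} = (z − α_l) f_{n−e_k} = (z − α_k) f_{n−e_k} + (α_k − α_l) f_{n−e_k}
-- = f_n + (α_k − α_l) f_{n−e_k}, and p ↦ Σ_{k ≤ M} p^(k)(αᵢ) is linear.
module Submission where

open import Defs
open import Level using (Level)
open import Algebra.Bundles using (CommutativeRing)
open import Data.Nat using (ℕ; _≥_)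
open import Data.Fin using (Fin)
open import Data.Fin using (zero; suc; _≟_)
open import Relation.Nullary using (¬_)
open import Data.Product using (_×_)
open import Relation.Binary.PropositionalEquality using (_≢_)
open import Relation.Binary.PropositionalEquality using (_≡_; _≗_)

open import Algebra.Bundles using (CommutativeMonoid; AbelianGroup)
open import Data.Nat as ℕ using (zero; suc; _≤_; z≤n; s≤s)
import Data.Nat.Properties as ℕₚ
open import Data.Fin.Properties using (all?; suc-injective)
open import Data.Integer as ℤ using (+_)
import Data.Integer.Properties as ℤₚ
import Algebra.Properties.Group (AbelianGroup.group ℤₚ.+-0-abelianGroup) as ℤ-Group
import Algebra.Properties.CommutativeSemigroup ℤₚ.+-commutativeSemigroup as ℤ-Props
open import Relation.Nullary using (yes; no; contradiction)
open import Data.Vec.Functional using (updateAt)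
open import Data.Vec.Functional.Properties
  using (updateAt-updates; updateAt-minimal; updateAt-id; updateAt-updateAt-local)
open import Data.List using ([]; _∷_; length)
open import Data.Product using (_,_)
open import Function using (_∘_)
open import Relation.Binary.Bundles using (Setoid)
open import Relation.Binary.Structures using (IsEquivalence)
import Relation.Binary.PropositionalEquality as ≡
import Relation.Binary.Reasoning.Setoid as ≈-Reasoning
import Algebra.Properties.CommutativeSemigroup as CommutativeSemigroupProperties
import Algebra.Properties.Monoid.Sum as MonoidSumProperties

module Polynomial {c ℓ : Level} (K : CommutativeRing c ℓ) where
  open WithRing K hiding (zero)
  import Algebra.Properties.Monoid.Mult +-monoid as Mult
  import Algebra.Properties.CommutativeMonoid.Mult +-commutativeMonoid as CommMult
  import Algebra.Properties.Semiring.Mult semiring as SemiringMult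

  module +-Props = CommutativeSemigroupProperties +-commutativeSemigroup
  module *-Props = CommutativeSemigroupProperties *-commutativeSemigroup

  ·-zeroʳ : ∀ n → n · 0# ≈ 0#
  ·-zeroʳ zero    = refl
  ·-zeroʳ (suc n) = trans (+-identityˡ _) (·-zeroʳ n)

  ·1#-* : ∀ m x → (m · 1#) * x ≈ m · x
  ·1#-* m x = trans (SemiringMult.×-assoc-* m 1# x) (Mult.×-congʳ m (*-identityˡ x))

  ·-congʳ-≥1 : ∀ m {x y} → (m ≥ 1 → x ≈ y) → m · x ≈ m · y
  ·-congʳ-≥1 zero    _   = refl
  ·-congʳ-≥1 (suc m) x≈y = Mult.×-congʳ (suc m) (x≈y (s≤s z≤n))

  coeff : Poly → ℕ → Carrier
  coeff []      _       = 0#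
  coeff (a ∷ p) zero    = a
  coeff (a ∷ p) (suc n) = coeff p n

  -- Coefficient lists are compared coefficientwise, so trailing zeros are invisible.
  infix 4 _≈ₚ_
  record _≈ₚ_ (p q : Poly) : Set ℓ where
    constructor coeffwise
    field coeff-≈ : ∀ n → coeff p n ≈ coeff q n
  open _≈ₚ_ public

  ≈ₚ-isEquivalence : IsEquivalence _≈ₚ_
  ≈ₚ-isEquivalence = record
    { refl  = coeffwise λ _ → refl
    ; sym   = λ p≈q → coeffwise λ n → sym (coeff-≈ p≈q n)
    ; trans = λ p≈q q≈r → coeffwise λ n → trans (coeff-≈ p≈q n) (coeff-≈ q≈r n)
    }

  ≈ₚ-setoid : Setoid c ℓ
  ≈ₚ-setoid = record { isEquivalence = ≈ₚ-isEquivalence }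

  open IsEquivalence ≈ₚ-isEquivalence public using ()
    renaming (refl to ≈ₚ-refl; sym to ≈ₚ-sym; trans to ≈ₚ-trans; reflexive to ≈ₚ-reflexive)

  ∷-cong : ∀ {a b p q} → a ≈ b → p ≈ₚ q → a ∷ p ≈ₚ b ∷ q
  ∷-cong a≈b p≈q = coeffwise λ { zero → a≈b ; (suc n) → coeff-≈ p≈q n }

  0∷[]≈[] : 0# ∷ [] ≈ₚ []
  0∷[]≈[] = coeffwise λ { zero → refl ; (suc n) → refl }

  ∷-≈[] : ∀ {a p} → a ≈ 0# → p ≈ₚ [] → a ∷ p ≈ₚ []
  ∷-≈[] a≈0 p≈[] = ≈ₚ-trans (∷-cong a≈0 p≈[]) 0∷[]≈[]

  coeff-⊕ : ∀ p q n → coeff (p ⊕ q) n ≈ coeff p n + coeff q n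
  coeff-⊕ []      q       n       = sym (+-identityˡ _)
  coeff-⊕ (a ∷ p) []      n       = sym (+-identityʳ _)
  coeff-⊕ (a ∷ p) (b ∷ q) zero    = refl
  coeff-⊕ (a ∷ p) (b ∷ q) (suc n) = coeff-⊕ p q n

  coeff-scale : ∀ a p n → coeff (scale a p) n ≈ a * coeff p n
  coeff-scale a []      n       = sym (zeroʳ a)
  coeff-scale a (b ∷ p) zero    = refl
  coeff-scale a (b ∷ p) (suc n) = coeff-scale a p n

  ⊕-cong : ∀ {p p′ q q′} → p ≈ₚ p′ → q ≈ₚ q′ → p ⊕ q ≈ₚ p′ ⊕ q′
  ⊕-cong {p} {p′} {q} {q′} p≈p′ q≈q′ = coeffwise λ n → begin
    coeff (p ⊕ q) n          ≈⟨ coeff-⊕ p q n ⟩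
    coeff p n + coeff q n    ≈⟨ +-cong (coeff-≈ p≈p′ n) (coeff-≈ q≈q′ n) ⟩
    coeff p′ n + coeff q′ n  ≈⟨ coeff-⊕ p′ q′ n ⟨
    coeff (p′ ⊕ q′) n        ∎
    where open ≈-Reasoning setoid

  ⊕-congˡ : ∀ p {q q′} → q ≈ₚ q′ → p ⊕ q ≈ₚ p ⊕ q′
  ⊕-congˡ p = ⊕-cong ≈ₚ-refl

  ⊕-congʳ : ∀ {p p′} q → p ≈ₚ p′ → p ⊕ q ≈ₚ p′ ⊕ q
  ⊕-congʳ q p≈p′ = ⊕-cong p≈p′ ≈ₚ-refl

  ⊕-assoc : ∀ p q r → (p ⊕ q) ⊕ r ≈ₚ p ⊕ (q ⊕ r)
  ⊕-assoc []      q       r       = ≈ₚ-refl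
  ⊕-assoc (a ∷ p) []      r       = ≈ₚ-refl
  ⊕-assoc (a ∷ p) (b ∷ q) []      = ≈ₚ-refl
  ⊕-assoc (a ∷ p) (b ∷ q) (c ∷ r) = ∷-cong (+-assoc a b c) (⊕-assoc p q r)

  ⊕-comm : ∀ p q → p ⊕ q ≈ₚ q ⊕ p
  ⊕-comm []      []      = ≈ₚ-refl
  ⊕-comm []      (b ∷ q) = ≈ₚ-refl
  ⊕-comm (a ∷ p) []      = ≈ₚ-refl
  ⊕-comm (a ∷ p) (b ∷ q) = ∷-cong (+-comm a b) (⊕-comm p q)

  ⊕-identityʳ : ∀ p → p ⊕ [] ≈ₚ p
  ⊕-identityʳ []      = ≈ₚ-refl
  ⊕-identityʳ (a ∷ p) = ≈ₚ-refl

  ⊕-commutativeMonoid : CommutativeMonoid c ℓ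
  ⊕-commutativeMonoid = record
    { _∙_ = _⊕_
    ; ε   = []
    ; isCommutativeMonoid = record
      { isMonoid = record
        { isSemigroup = record
          { isMagma = record { isEquivalence = ≈ₚ-isEquivalence ; ∙-cong = ⊕-cong }
          ; assoc   = ⊕-assoc
          }
        ; identity = (λ _ → ≈ₚ-refl) , ⊕-identityʳ
        }
      ; comm = ⊕-comm
      }
    }

  module ⊕-Props = CommutativeSemigroupProperties
    (CommutativeMonoid.commutativeSemigroup ⊕-commutativeMonoid)

  0∷-⊕ : ∀ p q → 0# ∷ (p ⊕ q) ≈ₚ (0# ∷ p) ⊕ (0# ∷ q)
  0∷-⊕ p q = ∷-cong (sym (+-identityʳ 0#)) ≈ₚ-refl

  scale-cong : ∀ {a b p q} → a ≈ b → p ≈ₚ q → scale a p ≈ₚ scale b q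
  scale-cong {a} {b} {p} {q} a≈b p≈q = coeffwise λ n → begin
    coeff (scale a p) n  ≈⟨ coeff-scale a p n ⟩
    a * coeff p n        ≈⟨ *-cong a≈b (coeff-≈ p≈q n) ⟩
    b * coeff q n        ≈⟨ coeff-scale b q n ⟨
    coeff (scale b q) n  ∎
    where open ≈-Reasoning setoid

  scale-distribˡ : ∀ a p q → scale a (p ⊕ q) ≈ₚ scale a p ⊕ scale a q
  scale-distribˡ a []      q       = ≈ₚ-refl
  scale-distribˡ a (b ∷ p) []      = ≈ₚ-refl
  scale-distribˡ a (b ∷ p) (c ∷ q) = ∷-cong (distribˡ a b c) (scale-distribˡ a p q)

  scale-distribʳ : ∀ a b p → scale (a + b) p ≈ₚ scale a p ⊕ scale b p
  scale-distribʳ a b []      = ≈ₚ-refl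
  scale-distribʳ a b (c ∷ p) = ∷-cong (distribʳ c a b) (scale-distribʳ a b p)

  scale-assoc : ∀ a b p → scale a (scale b p) ≈ₚ scale (a * b) p
  scale-assoc a b []      = ≈ₚ-refl
  scale-assoc a b (c ∷ p) = ∷-cong (sym (*-assoc a b c)) (scale-assoc a b p)

  scale-identity : ∀ p → scale 1# p ≈ₚ p
  scale-identity []      = ≈ₚ-refl
  scale-identity (a ∷ p) = ∷-cong (*-identityˡ a) (scale-identity p)

  scale-zero : ∀ p → scale 0# p ≈ₚ []
  scale-zero []      = ≈ₚ-refl
  scale-zero (a ∷ p) = ∷-≈[] (zeroˡ a) (scale-zero p)

  ⊗-congʳ : ∀ p {q q′} → q ≈ₚ q′ → p ⊗ q ≈ₚ p ⊗ q′
  ⊗-congʳ []      q≈q′ = ≈ₚ-refl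
  ⊗-congʳ (a ∷ p) q≈q′ = ⊕-cong (scale-cong refl q≈q′) (∷-cong refl (⊗-congʳ p q≈q′))

  ⊗-zeroʳ : ∀ p → p ⊗ [] ≈ₚ []
  ⊗-zeroʳ []      = ≈ₚ-refl
  ⊗-zeroʳ (a ∷ p) = ∷-≈[] refl (⊗-zeroʳ p)

  0∷-⊗ : ∀ p q → (0# ∷ p) ⊗ q ≈ₚ 0# ∷ (p ⊗ q)
  0∷-⊗ p q = ⊕-cong (scale-zero q) ≈ₚ-refl

  ⊗-∷ : ∀ p b q → p ⊗ (b ∷ q) ≈ₚ scale b p ⊕ (0# ∷ (p ⊗ q))
  ⊗-∷ []      b q = ≈ₚ-sym 0∷[]≈[]
  ⊗-∷ (a ∷ p) b q = ∷-cong (+-congʳ (*-comm a b)) (begin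
    scale a q ⊕ (p ⊗ (b ∷ q))                ≈⟨ ⊕-congˡ (scale a q) (⊗-∷ p b q) ⟩
    scale a q ⊕ (scale b p ⊕ (0# ∷ (p ⊗ q)))  ≈⟨ ⊕-Props.x∙yz≈y∙xz (scale a q) (scale b p) _ ⟩
    scale b p ⊕ (scale a q ⊕ (0# ∷ (p ⊗ q)))  ∎)
    where open ≈-Reasoning ≈ₚ-setoid

  ⊗-comm : ∀ p q → p ⊗ q ≈ₚ q ⊗ p
  ⊗-comm []      q = ≈ₚ-sym (⊗-zeroʳ q)
  ⊗-comm (a ∷ p) q = ≈ₚ-trans (⊕-congˡ (scale a q) (∷-cong refl (⊗-comm p q))) (≈ₚ-sym (⊗-∷ q a p))

  ⊗-congˡ : ∀ {p p′} q → p ≈ₚ p′ → p ⊗ q ≈ₚ p′ ⊗ q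
  ⊗-congˡ {p} {p′} q p≈p′ = ≈ₚ-trans (⊗-comm p q) (≈ₚ-trans (⊗-congʳ q p≈p′) (⊗-comm q p′))

  ⊗-cong : ∀ {p p′ q q′} → p ≈ₚ p′ → q ≈ₚ q′ → p ⊗ q ≈ₚ p′ ⊗ q′
  ⊗-cong {p′ = p′} {q = q} p≈p′ q≈q′ = ≈ₚ-trans (⊗-congˡ q p≈p′) (⊗-congʳ p′ q≈q′)

  ⊗-distribʳ : ∀ p p′ r → (p ⊕ p′) ⊗ r ≈ₚ (p ⊗ r) ⊕ (p′ ⊗ r)
  ⊗-distribʳ []      p′       r = ≈ₚ-refl
  ⊗-distribʳ (a ∷ p) []       r = ≈ₚ-sym (⊕-identityʳ _)
  ⊗-distribʳ (a ∷ p) (b ∷ p′) r = begin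
    scale (a + b) r ⊕ (0# ∷ ((p ⊕ p′) ⊗ r))
      ≈⟨ ⊕-cong (scale-distribʳ a b r) (∷-cong refl (⊗-distribʳ p p′ r)) ⟩
    (scale a r ⊕ scale b r) ⊕ (0# ∷ ((p ⊗ r) ⊕ (p′ ⊗ r)))
      ≈⟨ ⊕-congˡ (scale a r ⊕ scale b r) (0∷-⊕ (p ⊗ r) (p′ ⊗ r)) ⟩
    (scale a r ⊕ scale b r) ⊕ ((0# ∷ (p ⊗ r)) ⊕ (0# ∷ (p′ ⊗ r)))
      ≈⟨ ⊕-Props.interchange (scale a r) (scale b r) _ _ ⟩
    ((a ∷ p) ⊗ r) ⊕ ((b ∷ p′) ⊗ r) ∎
    where open ≈-Reasoning ≈ₚ-setoid

  ⊗-distribˡ : ∀ p q q′ → p ⊗ (q ⊕ q′) ≈ₚ (p ⊗ q) ⊕ (p ⊗ q′)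
  ⊗-distribˡ p q q′ = ≈ₚ-trans (⊗-comm p (q ⊕ q′))
    (≈ₚ-trans (⊗-distribʳ q q′ p) (⊕-cong (⊗-comm q p) (⊗-comm q′ p)))

  scale-⊗ : ∀ a p q → scale a p ⊗ q ≈ₚ scale a (p ⊗ q)
  scale-⊗ a []      q = ≈ₚ-refl
  scale-⊗ a (b ∷ p) q = begin
    scale (a * b) q ⊕ (0# ∷ (scale a p ⊗ q))
      ≈⟨ ⊕-cong (≈ₚ-sym (scale-assoc a b q)) (∷-cong (sym (zeroʳ a)) (scale-⊗ a p q)) ⟩
    scale a (scale b q) ⊕ scale a (0# ∷ (p ⊗ q))
      ≈⟨ scale-distribˡ a (scale b q) (0# ∷ (p ⊗ q)) ⟨
    scale a (scale b q ⊕ (0# ∷ (p ⊗ q)))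
      ∎
    where open ≈-Reasoning ≈ₚ-setoid

  ⊗-scale : ∀ a p q → p ⊗ scale a q ≈ₚ scale a (p ⊗ q)
  ⊗-scale a p q = ≈ₚ-trans (⊗-comm p _) (≈ₚ-trans (scale-⊗ a q p) (scale-cong refl (⊗-comm q p)))

  ⊗-assoc : ∀ p q r → (p ⊗ q) ⊗ r ≈ₚ p ⊗ (q ⊗ r)
  ⊗-assoc []      q r = ≈ₚ-refl
  ⊗-assoc (a ∷ p) q r = begin
    (scale a q ⊕ (0# ∷ (p ⊗ q))) ⊗ r
      ≈⟨ ⊗-distribʳ (scale a q) (0# ∷ (p ⊗ q)) r ⟩
    (scale a q ⊗ r) ⊕ ((0# ∷ (p ⊗ q)) ⊗ r)
      ≈⟨ ⊕-cong (scale-⊗ a q r) (0∷-⊗ (p ⊗ q) r) ⟩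
    scale a (q ⊗ r) ⊕ (0# ∷ ((p ⊗ q) ⊗ r))
      ≈⟨ ⊕-congˡ (scale a (q ⊗ r)) (∷-cong refl (⊗-assoc p q r)) ⟩
    scale a (q ⊗ r) ⊕ (0# ∷ (p ⊗ (q ⊗ r)))
      ∎
    where open ≈-Reasoning ≈ₚ-setoid

  ⊗-leftComm : ∀ p q r → p ⊗ (q ⊗ r) ≈ₚ q ⊗ (p ⊗ r)
  ⊗-leftComm p q r = ≈ₚ-trans (≈ₚ-sym (⊗-assoc p q r))
    (≈ₚ-trans (⊗-congˡ r (⊗-comm p q)) (⊗-assoc q p r))

  module ⊕-Sum = MonoidSumProperties (CommutativeMonoid.monoid ⊕-commutativeMonoid)

  sumₚ : ∀ {t} → (Fin t → Poly) → Poly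
  sumₚ = ⊕-Sum.sum

  ⊗-sumₚ : ∀ {t} p (g : Fin t → Poly) → p ⊗ sumₚ g ≈ₚ sumₚ (λ j → p ⊗ g j)
  ⊗-sumₚ {zero}  p g = ⊗-zeroʳ p
  ⊗-sumₚ {suc t} p g = ≈ₚ-trans (⊗-distribˡ p (g zero) (sumₚ (g ∘ suc)))
    (⊕-congˡ (p ⊗ g zero) (⊗-sumₚ p (g ∘ suc)))

  constP-⊗ : ∀ a q → constP a ⊗ q ≈ₚ scale a q
  constP-⊗ a q = ≈ₚ-trans (⊕-congˡ (scale a q) 0∷[]≈[]) (⊕-identityʳ (scale a q))

  linear-split : ∀ a b → linear b ≈ₚ linear a ⊕ constP (a - b)
  linear-split a b = ∷-cong (sym (begin
    - a + (a - b)  ≈⟨ +-assoc (- a) a (- b) ⟨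
    (- a + a) - b  ≈⟨ +-congʳ (-‿inverseˡ a) ⟩
    0# - b         ≈⟨ +-identityˡ (- b) ⟩
    - b            ∎)) ≈ₚ-refl
    where open ≈-Reasoning setoid

  ⊗-identityˡ : ∀ q → constP 1# ⊗ q ≈ₚ q
  ⊗-identityˡ q = ≈ₚ-trans (constP-⊗ 1# q) (scale-identity q)

  -- Formal derivative

  coeff-derivAux : ∀ k p n → coeff (derivAux k p) n ≈ (k ℕ.+ n) · coeff p n
  coeff-derivAux k []      n       = sym (·-zeroʳ (k ℕ.+ n))
  coeff-derivAux k (a ∷ p) zero    = Mult.×-congˡ (≡.sym (ℕₚ.+-identityʳ k))
  coeff-derivAux k (a ∷ p) (suc n) =
    trans (coeff-derivAux (suc k) p n) (Mult.×-congˡ (≡.sym (ℕₚ.+-suc k n)))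

  coeff-deriv : ∀ p n → coeff (deriv p) n ≈ suc n · coeff p (suc n)
  coeff-deriv []      n = sym (·-zeroʳ (suc n))
  coeff-deriv (a ∷ p) n = coeff-derivAux 1 p n

  deriv-cong : ∀ {p q} → p ≈ₚ q → deriv p ≈ₚ deriv q
  deriv-cong {p} {q} p≈q = coeffwise λ n → begin
    coeff (deriv p) n           ≈⟨ coeff-deriv p n ⟩
    suc n · coeff p (suc n)     ≈⟨ Mult.×-congʳ (suc n) (coeff-≈ p≈q (suc n)) ⟩
    suc n · coeff q (suc n)     ≈⟨ coeff-deriv q n ⟨
    coeff (deriv q) n           ∎
    where open ≈-Reasoning setoid

  deriv-⊕ : ∀ p q → deriv (p ⊕ q) ≈ₚ deriv p ⊕ deriv q
  deriv-⊕ p q = coeffwise λ n → begin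
    coeff (deriv (p ⊕ q)) n                             ≈⟨ coeff-deriv (p ⊕ q) n ⟩
    suc n · coeff (p ⊕ q) (suc n)                       ≈⟨ Mult.×-congʳ (suc n) (coeff-⊕ p q (suc n)) ⟩
    suc n · (coeff p (suc n) + coeff q (suc n))         ≈⟨ CommMult.×-distrib-+ _ _ (suc n) ⟩
    suc n · coeff p (suc n) + suc n · coeff q (suc n)   ≈⟨ +-cong (coeff-deriv p n) (coeff-deriv q n) ⟨
    coeff (deriv p) n + coeff (deriv q) n               ≈⟨ coeff-⊕ (deriv p) (deriv q) n ⟨
    coeff (deriv p ⊕ deriv q) n                         ∎
    where open ≈-Reasoning setoid

  deriv-scale : ∀ a p → deriv (scale a p) ≈ₚ scale a (deriv p)
  deriv-scale a p = coeffwise λ n → begin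
    coeff (deriv (scale a p)) n        ≈⟨ coeff-deriv (scale a p) n ⟩
    suc n · coeff (scale a p) (suc n)  ≈⟨ Mult.×-congʳ (suc n) (coeff-scale a p (suc n)) ⟩
    suc n · (a * coeff p (suc n))      ≈⟨ SemiringMult.×-comm-* (suc n) a _ ⟨
    a * (suc n · coeff p (suc n))      ≈⟨ *-congˡ (coeff-deriv p n) ⟨
    a * coeff (deriv p) n              ≈⟨ coeff-scale a (deriv p) n ⟨
    coeff (scale a (deriv p)) n        ∎
    where open ≈-Reasoning setoid

  deriv-∷ : ∀ a p → deriv (a ∷ p) ≈ₚ p ⊕ (0# ∷ deriv p)
  deriv-∷ a p = coeffwise λ n →
    trans (coeff-deriv (a ∷ p) n) (trans (product-rule n) (sym (coeff-⊕ p (0# ∷ deriv p) n)))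
    where
      product-rule : ∀ n → suc n · coeff p n ≈ coeff p n + coeff (0# ∷ deriv p) n
      product-rule zero    = refl
      product-rule (suc n) = +-congˡ (sym (coeff-deriv p n))

  deriv-⊗ : ∀ p q → deriv (p ⊗ q) ≈ₚ (deriv p ⊗ q) ⊕ (p ⊗ deriv q)
  deriv-⊗ []      q = ≈ₚ-refl
  deriv-⊗ (a ∷ p) q = begin
    deriv (scale a q ⊕ (0# ∷ (p ⊗ q)))
      ≈⟨ deriv-⊕ (scale a q) (0# ∷ (p ⊗ q)) ⟩
    deriv (scale a q) ⊕ deriv (0# ∷ (p ⊗ q))
      ≈⟨ ⊕-cong (deriv-scale a q) (deriv-∷ 0# (p ⊗ q)) ⟩
    scale a q′ ⊕ ((p ⊗ q) ⊕ (0# ∷ deriv (p ⊗ q)))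
      ≈⟨ ⊕-congˡ (scale a q′) (⊕-congˡ (p ⊗ q) (∷-cong refl (deriv-⊗ p q))) ⟩
    scale a q′ ⊕ ((p ⊗ q) ⊕ (0# ∷ ((p′ ⊗ q) ⊕ (p ⊗ q′))))
      ≈⟨ ⊕-congˡ (scale a q′) (⊕-congˡ (p ⊗ q) (0∷-⊕ (p′ ⊗ q) (p ⊗ q′))) ⟩
    scale a q′ ⊕ ((p ⊗ q) ⊕ ((0# ∷ (p′ ⊗ q)) ⊕ (0# ∷ (p ⊗ q′))))
      ≈⟨ ⊕-Props.x∙yz≈y∙xz (scale a q′) (p ⊗ q) _ ⟩
    (p ⊗ q) ⊕ (scale a q′ ⊕ ((0# ∷ (p′ ⊗ q)) ⊕ (0# ∷ (p ⊗ q′))))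
      ≈⟨ ⊕-congˡ (p ⊗ q) (⊕-Props.x∙yz≈y∙xz (scale a q′) (0# ∷ (p′ ⊗ q)) _) ⟩
    (p ⊗ q) ⊕ ((0# ∷ (p′ ⊗ q)) ⊕ (scale a q′ ⊕ (0# ∷ (p ⊗ q′))))
      ≈⟨ ⊕-assoc (p ⊗ q) (0# ∷ (p′ ⊗ q)) _ ⟨
    ((p ⊗ q) ⊕ (0# ∷ (p′ ⊗ q))) ⊕ (scale a q′ ⊕ (0# ∷ (p ⊗ q′)))
      ≈⟨ ⊕-congʳ ((a ∷ p) ⊗ q′) (⊕-congˡ (p ⊗ q) (0∷-⊗ p′ q)) ⟨
    ((p ⊗ q) ⊕ ((0# ∷ p′) ⊗ q)) ⊕ ((a ∷ p) ⊗ q′)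
      ≈⟨ ⊕-congʳ ((a ∷ p) ⊗ q′) (⊗-distribʳ p (0# ∷ p′) q) ⟨
    ((p ⊕ (0# ∷ p′)) ⊗ q) ⊕ ((a ∷ p) ⊗ q′)
      ≈⟨ ⊕-congʳ ((a ∷ p) ⊗ q′) (⊗-congˡ q (deriv-∷ a p)) ⟨
    (deriv (a ∷ p) ⊗ q) ⊕ ((a ∷ p) ⊗ q′) ∎
    where
      open ≈-Reasoning ≈ₚ-setoid
      p′ = deriv p
      q′ = deriv q

  deriv-^P : ∀ p m → deriv (p ^P m) ≈ₚ scale (m · 1#) (deriv p ⊗ (p ^P ℕ.pred m))
  deriv-^P p zero    = ≈ₚ-sym (scale-zero _)
  deriv-^P p (suc m) = begin
    deriv (p ⊗ (p ^P m))
      ≈⟨ deriv-⊗ p (p ^P m) ⟩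
    (p′ ⊗ (p ^P m)) ⊕ (p ⊗ deriv (p ^P m))
      ≈⟨ ⊕-congˡ (p′ ⊗ (p ^P m)) (⊗-congʳ p (deriv-^P p m)) ⟩
    (p′ ⊗ (p ^P m)) ⊕ (p ⊗ scale (m · 1#) (p′ ⊗ (p ^P ℕ.pred m)))
      ≈⟨ ⊕-cong (≈ₚ-sym (scale-identity _)) (absorb m) ⟩
    scale 1# (p′ ⊗ (p ^P m)) ⊕ scale (m · 1#) (p′ ⊗ (p ^P m))
      ≈⟨ scale-distribʳ 1# (m · 1#) _ ⟨
    scale (suc m · 1#) (p′ ⊗ (p ^P m))
      ∎
    where
      open ≈-Reasoning ≈ₚ-setoid
      p′ = deriv p
      absorb : ∀ m → p ⊗ scale (m · 1#) (p′ ⊗ (p ^P ℕ.pred m))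
                     ≈ₚ scale (m · 1#) (p′ ⊗ (p ^P m))
      absorb zero    = ≈ₚ-trans (⊗-scale 0# p _)
                                (≈ₚ-trans (scale-zero _) (≈ₚ-sym (scale-zero _)))
      absorb (suc m) = ≈ₚ-trans (⊗-scale _ p _) (scale-cong refl (⊗-leftComm p p′ (p ^P m)))

  deriv-linear : ∀ a → deriv (linear a) ≈ₚ constP 1#
  deriv-linear a = ∷-cong (+-identityʳ 1#) ≈ₚ-refl

  deriv^-cong : ∀ k {p q} → p ≈ₚ q → deriv^ k p ≈ₚ deriv^ k q
  deriv^-cong zero    p≈q = p≈q
  deriv^-cong (suc k) p≈q = deriv-cong (deriv^-cong k p≈q)

  deriv^-⊕ : ∀ k p q → deriv^ k (p ⊕ q) ≈ₚ deriv^ k p ⊕ deriv^ k q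
  deriv^-⊕ zero    p q = ≈ₚ-refl
  deriv^-⊕ (suc k) p q = ≈ₚ-trans (deriv-cong (deriv^-⊕ k p q)) (deriv-⊕ (deriv^ k p) (deriv^ k q))

  deriv^-scale : ∀ k a p → deriv^ k (scale a p) ≈ₚ scale a (deriv^ k p)
  deriv^-scale zero    a p = ≈ₚ-refl
  deriv^-scale (suc k) a p = ≈ₚ-trans (deriv-cong (deriv^-scale k a p)) (deriv-scale a (deriv^ k p))

  deriv^-[] : ∀ k → deriv^ k [] ≡ []
  deriv^-[] zero    = ≡.refl
  deriv^-[] (suc k) = ≡.cong deriv (deriv^-[] k)

  deriv^-deriv : ∀ k p → deriv^ k (deriv p) ≡ deriv (deriv^ k p)
  deriv^-deriv zero    p = ≡.refl
  deriv^-deriv (suc k) p = ≡.cong deriv (deriv^-deriv k p)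

  eval-≈[] : ∀ {p} x → p ≈ₚ [] → eval p x ≈ 0#
  eval-≈[] {[]}    x p≈[] = refl
  eval-≈[] {a ∷ p} x p≈[] = begin
    a + x * eval p x
      ≈⟨ +-cong (coeff-≈ p≈[] 0) (*-congˡ (eval-≈[] {p} x (coeffwise (coeff-≈ p≈[] ∘ suc)))) ⟩
    0# + x * 0#       ≈⟨ +-identityˡ _ ⟩
    x * 0#            ≈⟨ zeroʳ x ⟩
    0#                ∎
    where open ≈-Reasoning setoid

  eval-cong : ∀ {p q} x → p ≈ₚ q → eval p x ≈ eval q x
  eval-cong {[]}    {q}     x p≈q = sym (eval-≈[] x (≈ₚ-sym p≈q))
  eval-cong {a ∷ p} {[]}    x p≈q = eval-≈[] x p≈q
  eval-cong {a ∷ p} {b ∷ q} x p≈q =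
    +-cong (coeff-≈ p≈q 0) (*-congˡ (eval-cong {p} {q} x (coeffwise (coeff-≈ p≈q ∘ suc))))

  eval-⊕ : ∀ p q x → eval (p ⊕ q) x ≈ eval p x + eval q x
  eval-⊕ []      q       x = sym (+-identityˡ _)
  eval-⊕ (a ∷ p) []      x = sym (+-identityʳ _)
  eval-⊕ (a ∷ p) (b ∷ q) x = begin
    (a + b) + x * eval (p ⊕ q) x              ≈⟨ +-congˡ (*-congˡ (eval-⊕ p q x)) ⟩
    (a + b) + x * (eval p x + eval q x)       ≈⟨ +-congˡ (distribˡ x _ _) ⟩
    (a + b) + (x * eval p x + x * eval q x)   ≈⟨ +-Props.interchange a b _ _ ⟩
    (a + x * eval p x) + (b + x * eval q x)   ∎
    where open ≈-Reasoning setoid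

  eval-scale : ∀ a p x → eval (scale a p) x ≈ a * eval p x
  eval-scale a []      x = sym (zeroʳ a)
  eval-scale a (b ∷ p) x = begin
    a * b + x * eval (scale a p) x   ≈⟨ +-congˡ (*-congˡ (eval-scale a p x)) ⟩
    a * b + x * (a * eval p x)       ≈⟨ +-congˡ (*-Props.x∙yz≈y∙xz x a _) ⟩
    a * b + a * (x * eval p x)       ≈⟨ distribˡ a b _ ⟨
    a * (b + x * eval p x)           ∎
    where open ≈-Reasoning setoid

  length-⊕ : ∀ {N} p q → length p ≤ N → length q ≤ N → length (p ⊕ q) ≤ N
  length-⊕ []      q       _         q≤N       = q≤N
  length-⊕ (a ∷ p) []      p≤N       _         = p≤N
  length-⊕ (a ∷ p) (b ∷ q) (s≤s p≤N) (s≤s q≤N) = s≤s (length-⊕ p q p≤N q≤N)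

  length-scale : ∀ a p → length (scale a p) ≡ length p
  length-scale a []      = ≡.refl
  length-scale a (b ∷ p) = ≡.cong suc (length-scale a p)

  length-⊗ : ∀ {m n} p q → length p ≤ suc m → length q ≤ suc n →
             length (p ⊗ q) ≤ suc (m ℕ.+ n)
  length-⊗ []      q _ _ = z≤n
  length-⊗ {m} {n} (a ∷ p) q (s≤s p≤m) q≤n =
    length-⊕ (scale a q) (0# ∷ (p ⊗ q)) scale-bound (shift-bound m p p≤m)
    where
      scale-bound : length (scale a q) ≤ suc (m ℕ.+ n)
      scale-bound = ≡.subst (_≤ suc (m ℕ.+ n)) (≡.sym (length-scale a q))
                            (ℕₚ.≤-trans q≤n (s≤s (ℕₚ.m≤n+m n m)))
      shift-bound : ∀ m p → length p ≤ m → length (0# ∷ (p ⊗ q)) ≤ suc (m ℕ.+ n)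
      shift-bound zero    []  _   = s≤s z≤n
      shift-bound (suc m) p   p≤m = s≤s (length-⊗ p q p≤m q≤n)

  length-^P : ∀ {p d} m → length p ≤ suc d → length (p ^P m) ≤ suc (m ℕ.* d)
  length-^P zero    _ = s≤s z≤n
  length-^P {p} (suc m) p≤d = length-⊗ p (p ^P m) p≤d (length-^P m p≤d)

  length-derivAux : ∀ k p → length (derivAux k p) ≡ length p
  length-derivAux k []      = ≡.refl
  length-derivAux k (a ∷ p) = ≡.cong suc (length-derivAux (suc k) p)

  deriv^-vanishes : ∀ k p → length p ≤ k → deriv^ k p ≡ []
  deriv^-vanishes zero    []      _       = ≡.refl
  deriv^-vanishes (suc k) []      _       = deriv^-[] (suc k)
  deriv^-vanishes (suc k) (a ∷ p) (s≤s p≤k) = ≡.trans (≡.sym (deriv^-deriv k (a ∷ p)))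
    (deriv^-vanishes k (derivAux 1 p) (≡.subst (_≤ k) (≡.sym (length-derivAux 1 p)) p≤k))

module PointsProperties {c ℓ : Level} (K : CommutativeRing c ℓ)
                        {s : ℕ} (α : Fin s → CommutativeRing.Carrier K) where
  open WithRing K hiding (zero)
  open Polynomial K
  open Points α
  module KSum = MonoidSumProperties +-monoid

  -- Products over Fin t and the polynomials f_m

  prodP-cong : ∀ {t} {g h : Fin t → Poly} → (∀ i → g i ≈ₚ h i) → prodP g ≈ₚ prodP h
  prodP-cong {zero}  g≈h = ≈ₚ-refl
  prodP-cong {suc t} g≈h = ⊗-cong (g≈h zero) (prodP-cong (g≈h ∘ suc))

  prodP-cong-≗ : ∀ {t} {g h : Fin t → Poly} → g ≗ h → prodP g ≡ prodP h
  prodP-cong-≗ {zero}  g≗h = ≡.refl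
  prodP-cong-≗ {suc t} g≗h = ≡.cong₂ _⊗_ (g≗h zero) (prodP-cong-≗ (g≗h ∘ suc))

  prodP-factor : ∀ {t} (g h : Fin t → Poly) j q →
                 (∀ i → i ≢ j → g i ≈ₚ h i) → g j ≈ₚ q ⊗ h j → prodP g ≈ₚ q ⊗ prodP h
  prodP-factor g h zero    q g≈h gj≈qhj = ≈ₚ-trans
    (⊗-cong gj≈qhj (prodP-cong λ i → g≈h (suc i) λ ()))
    (⊗-assoc q (h zero) _)
  prodP-factor g h (suc j) q g≈h gj≈qhj = ≈ₚ-trans
    (⊗-cong (g≈h zero λ ()) (prodP-factor (g ∘ suc) (h ∘ suc) j q g≈h′ gj≈qhj))
    (⊗-leftComm (h zero) q _)
    where
      g≈h′ : ∀ i → i ≢ j → g (suc i) ≈ₚ h (suc i)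
      g≈h′ i i≢j = g≈h (suc i) (i≢j ∘ suc-injective)

  deriv-prodP : ∀ {t} (g : Fin t → Poly) → deriv (prodP g) ≈ₚ sumₚ (λ j → prodP (updateAt g j deriv))
  deriv-prodP {zero}  g = ≈ₚ-refl
  deriv-prodP {suc t} g = ≈ₚ-trans (deriv-⊗ (g zero) (prodP (g ∘ suc)))
    (⊕-congˡ (deriv (g zero) ⊗ prodP (g ∘ suc))
      (≈ₚ-trans (⊗-congʳ (g zero) (deriv-prodP (g ∘ suc)))
                (⊗-sumₚ (g zero) (λ j → prodP (updateAt (g ∘ suc) j deriv)))))

  length-prodP : ∀ {t} (g : Fin t → Poly) (m : Fin t → ℕ) →
                 (∀ i → length (g i) ≤ suc (m i)) → length (prodP g) ≤ suc (total m)
  length-prodP {zero}  g m _       = s≤s z≤n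
  length-prodP {suc t} g m g≤m =
    length-⊗ (g zero) _ (g≤m zero) (length-prodP (g ∘ suc) (m ∘ suc) (g≤m ∘ suc))

  power : Fin s → ℕ → Poly
  power i k = linear (α i) ^P k

  deriv-power : ∀ i k → deriv (power i k) ≈ₚ scale (k · 1#) (power i (ℕ.pred k))
  deriv-power i k = ≈ₚ-trans (deriv-^P (linear (α i)) k)
    (scale-cong refl (≈ₚ-trans (⊗-congˡ (power i (ℕ.pred k)) (deriv-linear (α i))) (⊗-identityˡ _)))

  f-cong : ∀ {m m′} → m ≗ m′ → f m ≡ f m′
  f-cong m≗m′ = prodP-cong-≗ (λ i → ≡.cong (power i) (m≗m′ i))

  f-updateAt-suc : ∀ m j → f (updateAt m j suc) ≈ₚ linear (α j) ⊗ f m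
  f-updateAt-suc m j = prodP-factor _ _ j (linear (α j))
    (λ i i≢j → ≈ₚ-reflexive (≡.cong (power i) (updateAt-minimal i j m i≢j)))
    (≈ₚ-reflexive (≡.cong (power j) (updateAt-updates j m)))

  f-shift : ∀ m k l → f (updateAt m l suc) ≈ₚ f (updateAt m k suc) ⊕ scale (α k - α l) (f m)
  f-shift m k l = begin
    f (updateAt m l suc)
      ≈⟨ f-updateAt-suc m l ⟩
    linear (α l) ⊗ f m
      ≈⟨ ⊗-congˡ (f m) (linear-split (α k) (α l)) ⟩
    (linear (α k) ⊕ constP (α k - α l)) ⊗ f m
      ≈⟨ ⊗-distribʳ (linear (α k)) (constP (α k - α l)) (f m) ⟩
    (linear (α k) ⊗ f m) ⊕ (constP (α k - α l) ⊗ f m)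
      ≈⟨ ⊕-cong (≈ₚ-sym (f-updateAt-suc m k)) (constP-⊗ _ (f m)) ⟩
    f (updateAt m k suc) ⊕ scale (α k - α l) (f m)
      ∎
    where
      open ≈-Reasoning ≈ₚ-setoid

  deriv-f : ∀ m → deriv (f m) ≈ₚ sumₚ (λ j → scale (m j · 1#) (f (updateAt m j ℕ.pred)))
  deriv-f m = ≈ₚ-trans (deriv-prodP powers) (⊕-Sum.sum-cong-≋ λ j →
    ≈ₚ-trans (differentiate-factor j) (constP-⊗ (m j · 1#) (f (updateAt m j ℕ.pred))))
    where
      powers : Fin s → Poly
      powers i = power i (m i)

      differentiate-factor : ∀ j → prodP (updateAt powers j deriv)
                                   ≈ₚ constP (m j · 1#) ⊗ f (updateAt m j ℕ.pred)
      differentiate-factor j = prodP-factor _ _ j (constP (m j · 1#)) others differentiated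
        where
          others : ∀ i → i ≢ j → updateAt powers j deriv i ≈ₚ power i (updateAt m j ℕ.pred i)
          others i i≢j = ≈ₚ-reflexive (≡.trans (updateAt-minimal i j powers i≢j)
                                               (≡.cong (power i) (≡.sym (updateAt-minimal i j m i≢j))))

          differentiated : updateAt powers j deriv j
                           ≈ₚ constP (m j · 1#) ⊗ power j (updateAt m j ℕ.pred j)
          differentiated rewrite updateAt-updates j {deriv} powers | updateAt-updates j {ℕ.pred} m =
            ≈ₚ-trans (deriv-power j (m j)) (≈ₚ-sym (constP-⊗ (m j · 1#) _))

  length-f : ∀ m → length (f m) ≤ suc (total m)
  length-f m = length-prodP _ m λ i →
    ≡.subst (λ k → length (power i (m i)) ≤ suc k) (ℕₚ.*-identityʳ (m i))
            (length-^P (m i) (ℕₚ.≤-refl {2}))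

  -- Sums of derivatives

  sumUpTo-cong : ∀ N {g h : ℕ → Carrier} → (∀ k → g k ≈ h k) → sumUpTo N g ≈ sumUpTo N h
  sumUpTo-cong zero    g≈h = g≈h 0
  sumUpTo-cong (suc N) g≈h = +-cong (sumUpTo-cong N g≈h) (g≈h (suc N))

  sumUpTo-+ : ∀ N (g h : ℕ → Carrier) → sumUpTo N (λ k → g k + h k) ≈ sumUpTo N g + sumUpTo N h
  sumUpTo-+ zero    g h = refl
  sumUpTo-+ (suc N) g h =
    trans (+-congʳ (sumUpTo-+ N g h)) (+-Props.interchange _ _ (g (suc N)) (h (suc N)))

  sumUpTo-* : ∀ N a (g : ℕ → Carrier) → sumUpTo N (λ k → a * g k) ≈ a * sumUpTo N g
  sumUpTo-* zero    a g = refl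
  sumUpTo-* (suc N) a g = trans (+-congʳ (sumUpTo-* N a g)) (sym (distribˡ a _ (g (suc N))))

  sumUpTo-suc : ∀ N (g : ℕ → Carrier) → sumUpTo (suc N) g ≈ g 0 + sumUpTo N (g ∘ suc)
  sumUpTo-suc zero    g = refl
  sumUpTo-suc (suc N) g = trans (+-congʳ (sumUpTo-suc N g)) (+-assoc (g 0) _ (g (suc (suc N))))

  -- evalP m x is definitionally derivSum (total m) (f m) x.
  derivSum : ℕ → Poly → Carrier → Carrier
  derivSum N p x = sumUpTo N (λ k → eval (deriv^ k p) x)

  derivSum-cong : ∀ N x {p q} → p ≈ₚ q → derivSum N p x ≈ derivSum N q x
  derivSum-cong N x p≈q = sumUpTo-cong N λ k → eval-cong x (deriv^-cong k p≈q)

  derivSum-⊕ : ∀ N p q x → derivSum N (p ⊕ q) x ≈ derivSum N p x + derivSum N q x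
  derivSum-⊕ N p q x = trans
    (sumUpTo-cong N λ k → trans (eval-cong x (deriv^-⊕ k p q)) (eval-⊕ (deriv^ k p) (deriv^ k q) x))
    (sumUpTo-+ N _ _)

  derivSum-scale : ∀ N a p x → derivSum N (scale a p) x ≈ a * derivSum N p x
  derivSum-scale N a p x = trans
    (sumUpTo-cong N λ k → trans (eval-cong x (deriv^-scale k a p)) (eval-scale a (deriv^ k p) x))
    (sumUpTo-* N a _)

  derivSum-[] : ∀ N x → derivSum N [] x ≈ 0#
  derivSum-[] zero    x = refl
  derivSum-[] (suc N) x rewrite deriv^-[] (suc N) = trans (+-identityʳ _) (derivSum-[] N x)

  derivSum-sumₚ : ∀ N {t} (g : Fin t → Poly) x →
                  derivSum N (sumₚ g) x ≈ sum (λ j → derivSum N (g j) x)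
  derivSum-sumₚ N {zero}  g x = derivSum-[] N x
  derivSum-sumₚ N {suc t} g x =
    trans (derivSum-⊕ N (g zero) _ x) (+-congˡ (derivSum-sumₚ N (g ∘ suc) x))

  derivSum-suc : ∀ N p x → derivSum (suc N) p x ≈ eval p x + derivSum N (deriv p) x
  derivSum-suc N p x = trans (sumUpTo-suc N _)
    (+-congˡ (sumUpTo-cong N λ k → reflexive (≡.cong (λ q → eval q x) (≡.sym (deriv^-deriv k p)))))

  derivSum-extend : ∀ N p x → length p ≤ suc N → derivSum (suc N) p x ≈ derivSum N p x
  derivSum-extend N p x p≤N rewrite deriv^-vanishes (suc N) p p≤N = +-identityʳ _

  total-cong : ∀ {t} {m m′ : Fin t → ℕ} → m ≗ m′ → total m ≡ total m′
  total-cong {zero}  m≗m′ = ≡.refl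
  total-cong {suc t} m≗m′ = ≡.cong₂ ℕ._+_ (m≗m′ zero) (total-cong (m≗m′ ∘ suc))

  total-updateAt-suc : ∀ {t} (m : Fin t → ℕ) j → total (updateAt m j suc) ≡ suc (total m)
  total-updateAt-suc m zero    = ≡.refl
  total-updateAt-suc m (suc j) = ≡.trans (≡.cong (m zero ℕ.+_) (total-updateAt-suc (m ∘ suc) j))
                                          (ℕₚ.+-suc (m zero) _)

  updateAt-suc-pred : ∀ {t} (m : Fin t → ℕ) j → m j ≥ 1 → updateAt (updateAt m j ℕ.pred) j suc ≗ m
  updateAt-suc-pred m j mj≥1 i = ≡.trans
    (updateAt-updateAt-local j m (ℕₚ.suc-pred (m j) {{ℕ.>-nonZero mj≥1}}) i) (updateAt-id j m i)

  total-updateAt-pred : ∀ {t} (m : Fin t → ℕ) j → m j ≥ 1 →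
                        total m ≡ suc (total (updateAt m j ℕ.pred))
  total-updateAt-pred m j mj≥1 = ≡.trans
    (total-cong (≡.sym ∘ updateAt-suc-pred m j mj≥1)) (total-updateAt-suc (updateAt m j ℕ.pred) j)

  ↑-⊞-e : ∀ {t} (m : Fin t → ℕ) j → ↑ m ⊞ e j ≗ ↑ (updateAt m j suc)
  -- Matching on i ≟ j also evaluates e j i, which is defined by the same test.
  ↑-⊞-e m j i with i ≟ j
  ... | yes ≡.refl rewrite updateAt-updates i {suc} m = ≡.cong +_ (ℕₚ.+-comm (m i) 1)
  ... | no i≢j rewrite updateAt-minimal i j {suc} m i≢j = ≡.cong +_ (ℕₚ.+-identityʳ (m i))

  ↑-updateAt-pred : ∀ {t} (m : Fin t → ℕ) j → m j ≥ 1 → ↑ m ≗ ↑ (updateAt m j ℕ.pred) ⊞ e j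
  ↑-updateAt-pred m j mj≥1 i = ≡.trans (≡.cong +_ (≡.sym (updateAt-suc-pred m j mj≥1 i)))
                                       (≡.sym (↑-⊞-e (updateAt m j ℕ.pred) j i))

  ↑-⊟-e : ∀ {t} (m : Fin t → ℕ) j → m j ≥ 1 → ↑ m ⊟ e j ≗ ↑ (updateAt m j ℕ.pred)
  ↑-⊟-e m j mj≥1 i = ≡.trans (≡.cong (ℤ._- e j i) (↑-updateAt-pred m j mj≥1 i))
                             (ℤ-Group.//-rightDividesʳ (e j i) (+ updateAt m j ℕ.pred i))

  ↑-⊞-e-⊟-e : ∀ {t} (m : Fin t → ℕ) k l → m k ≥ 1 →
              (↑ m ⊞ e l) ⊟ e k ≗ ↑ (updateAt (updateAt m k ℕ.pred) l suc)
  ↑-⊞-e-⊟-e m k l mk≥1 i = begin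
    (+ m i ℤ.+ e l i) ℤ.- e k i
      ≡⟨ ≡.cong (λ z → (z ℤ.+ e l i) ℤ.- e k i) (↑-updateAt-pred m k mk≥1 i) ⟩
    ((+ d i ℤ.+ e k i) ℤ.+ e l i) ℤ.- e k i
      ≡⟨ ≡.cong (ℤ._- e k i) (ℤ-Props.xy∙z≈xz∙y (+ d i) (e k i) (e l i)) ⟩
    ((+ d i ℤ.+ e l i) ℤ.+ e k i) ℤ.- e k i
      ≡⟨ ℤ-Group.//-rightDividesʳ (e k i) (+ d i ℤ.+ e l i) ⟩
    + d i ℤ.+ e l i
      ≡⟨ ↑-⊞-e d l i ⟩
    + updateAt d l suc i
      ∎
    where
      open ≡.≡-Reasoning
      d = updateAt m k ℕ.pred

  evalP-cong : ∀ {m m′} → m ≗ m′ → ∀ x → evalP m x ≡ evalP m′ x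
  evalP-cong m≗m′ x = ≡.cong₂ (λ N p → derivSum N p x) (total-cong m≗m′) (f-cong m≗m′)

  a-↑ : ∀ {z m} → z ≗ ↑ m → ∀ i → a z i ≡ evalP m (α i)
  a-↑ {z} z≗m i with all? (λ i → + 0 ℤ.≤? z i)
  ... | yes _   = evalP-cong (λ j → ≡.cong ℤ.∣_∣ (z≗m j)) (α i)
  ... | no z≱0 = contradiction (λ j → ≡.subst (+ 0 ℤ.≤_) (≡.sym (z≗m j)) (ℤ.+≤+ z≤n)) z≱0

  a-⊟-e : ∀ n j → n j ≥ 1 →
          ∀ i → a (↑ n ⊟ e j) i ≈ derivSum (total n) (f (updateAt n j ℕ.pred)) (α i)
  a-⊟-e n j nj≥1 i = begin
    a (↑ n ⊟ e j) i
      ≡⟨ a-↑ (↑-⊟-e n j nj≥1) i ⟩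
    derivSum (total d) (f d) x
      ≈⟨ derivSum-extend (total d) (f d) x (length-f d) ⟨
    derivSum (suc (total d)) (f d) x
      ≡⟨ ≡.cong (λ N → derivSum N (f d) x) (total-updateAt-pred n j nj≥1) ⟨
    derivSum (total n) (f d) x
      ∎
    where
      open ≈-Reasoning setoid
      d = updateAt n j ℕ.pred
      x = α i

  a-recurrence : ∀ n i → a (↑ n) i ≈ eval (f n) (α i) + sum (λ j → n j · a (↑ n ⊟ e j) i)
  a-recurrence n i = begin
    a (↑ n) i                                         ≡⟨ a-↑ (λ _ → ≡.refl) i ⟩
    derivSum M (f n) x                                ≈⟨ derivSum-extend M (f n) x (length-f n) ⟨
    derivSum (suc M) (f n) x                          ≈⟨ derivSum-suc M (f n) x ⟩
    eval (f n) x + derivSum M (deriv (f n)) x         ≈⟨ +-congˡ (derivSum-cong M x (deriv-f n)) ⟩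
    eval (f n) x + derivSum M (sumₚ g) x              ≈⟨ +-congˡ (derivSum-sumₚ M g x) ⟩
    eval (f n) x + sum (λ j → derivSum M (g j) x)     ≈⟨ +-congˡ (KSum.sum-cong-≋ term) ⟩
    eval (f n) x + sum (λ j → n j · a (↑ n ⊟ e j) i)  ∎
    where
      open ≈-Reasoning setoid
      M = total n
      x = α i
      g = λ j → scale (n j · 1#) (f (updateAt n j ℕ.pred))
      term : ∀ j → derivSum M (g j) x ≈ n j · a (↑ n ⊟ e j) i
      term j = trans (derivSum-scale M (n j · 1#) _ x)
        (trans (·1#-* (n j) _) (·-congʳ-≥1 (n j) λ nj≥1 → sym (a-⊟-e n j nj≥1 i)))

  a-shift : ∀ n k l → n k ≥ 1 →
            ∀ i → a ((↑ n ⊞ e l) ⊟ e k) i ≈ a (↑ n) i + (α k - α l) * a (↑ n ⊟ e k) i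
  a-shift n k l nk≥1 i = begin
    a ((↑ n ⊞ e l) ⊟ e k) i
      ≡⟨ a-↑ (↑-⊞-e-⊟-e n k l nk≥1) i ⟩
    derivSum (total m′) (f m′) x
      ≡⟨ ≡.cong (λ N → derivSum N (f m′) x) total-m′ ⟩
    derivSum M (f m′) x
      ≈⟨ derivSum-cong M x (f-shift d k l) ⟩
    derivSum M (f (updateAt d k suc) ⊕ scale δ (f d)) x
      ≈⟨ derivSum-⊕ M _ (scale δ (f d)) x ⟩
    derivSum M (f (updateAt d k suc)) x + derivSum M (scale δ (f d)) x
      ≈⟨ +-cong (reflexive (≡.cong (λ p → derivSum M p x) (f-cong (updateAt-suc-pred n k nk≥1))))
                (derivSum-scale M δ (f d) x) ⟩
    derivSum M (f n) x + δ * derivSum M (f d) x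
      ≈⟨ +-cong (reflexive (≡.sym (a-↑ (λ _ → ≡.refl) i))) (*-congˡ (sym (a-⊟-e n k nk≥1 i))) ⟩
    a (↑ n) i + δ * a (↑ n ⊟ e k) i
      ∎
    where
      open ≈-Reasoning setoid
      M = total n
      x = α i
      δ = α k - α l
      d = updateAt n k ℕ.pred
      m′ = updateAt d l suc
      total-m′ : total m′ ≡ M
      total-m′ = ≡.trans (total-updateAt-suc d l) (≡.sym (total-updateAt-pred n k nk≥1))

propositionA1 : {c ℓ : Level} (K : CommutativeRing c ℓ) →
    let open WithRing K in
    IsNumberField →
    {s : ℕ} (α : Fin s → Carrier) →
    (∀ i j → i ≢ j → ¬ (α i ≈ α j)) →
    let open Points α in
    (n : Fin s → ℕ) →
      (∀ i → a (↑ n) i ≈ eval (f n) (α i) + sum (λ j → n j · a (↑ n ⊟ e j) i))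
      × (∀ (k l : Fin s) → n k ≥ 1 →
           ∀ i → a ((↑ n ⊞ e l) ⊟ e k) i ≈ a (↑ n) i + (α k - α l) * a (↑ n ⊟ e k) i)
propositionA1 K _ α _ n = a-recurrence n , a-shift n
  where open PointsProperties K α
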